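{- Let $G$ be a finite simple graph with $n$ vertices and $\alpha(G)>n/2$. Then: (i) if the number of isolated vertices of $G$ is not $1$, then $\xi(G)\geq 2$; (ii) if $\xi(G)=1$, then $G$ has exactly one isolated vertex; (iii) $\xi(G)=0$ never holds.
   Context: $\alpha(G)$ is the maximum size of a stable set of $G$; $\Omega(G)$ is the set of maximum stable sets; $core(G)=\bigcap\{S:S\in\Omega(G)\}$ and $\xi(G)=|core(G)|$. -}

module Defs where

open import Data.Nat using (ℕ; zero; suc; _⊔_)
open import Data.Bool using (Bool; true; false; _∧_; _∨_; not; if_then_else_)
open import Data.Fin using (Fin; zero; suc)
open import Data.Vec using (Vec; []; _∷_; lookup; tabulate)
open import Data.List using (List; []; _∷_; map; _++_; filter; foldr)
open import Data.Bool.ListAction using (all; any)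
open import Data.Fin.Subset using (Subset; ∣_∣; inside; outside)
open import Relation.Binary.PropositionalEquality using (_≡_)
open import Relation.Nullary.Decidable using (T?)

record Graph (n : ℕ) : Set where
  field
    adj    : Fin n → Fin n → Bool
    sym    : ∀ u v → adj u v ≡ adj v u
    irrefl : ∀ v → adj v v ≡ false
open Graph public

vertices : (n : ℕ) → List (Fin n)
vertices zero    = []
vertices (suc n) = zero ∷ map suc (vertices n)

allSubsets : (n : ℕ) → List (Subset n)
allSubsets zero    = [] ∷ []
allSubsets (suc n) = map (inside ∷_) (allSubsets n) ++ map (outside ∷_) (allSubsets n)

isStable : ∀ {n} → Graph n → Subset n → Bool
isStable {n} G S =
  all (λ u → all (λ v → not (lookup S u ∧ lookup S v ∧ adj G u v)) (vertices n)) (vertices n)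

stableSets : ∀ {n} → Graph n → List (Subset n)
stableSets {n} G = filter (λ S → T? (isStable G S)) (allSubsets n)

α : ∀ {n} → Graph n → ℕ
α G = foldr _⊔_ 0 (map ∣_∣ (stableSets G))

isMaxStable : ∀ {n} → Graph n → Subset n → Bool
isMaxStable G S = isStable G S ∧ (∣ S ∣ Data.Nat.≡ᵇ α G)

Ω : ∀ {n} → Graph n → List (Subset n)
Ω {n} G = filter (λ S → T? (isMaxStable G S)) (allSubsets n)

core : ∀ {n} → Graph n → Subset n
core G = tabulate (λ v → all (λ S → lookup S v) (Ω G))

ξ : ∀ {n} → Graph n → ℕ
ξ G = ∣ core G ∣

isIsolated : ∀ {n} → Graph n → Fin n → Bool
isIsolated {n} G v = not (any (adj G v) (vertices n))

isolated : ∀ {n} → Graph n → Subset n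
isolated G = tabulate (isIsolated G)

numIsolated : ∀ {n} → Graph n → ℕ
numIsolated G = ∣ isolated G ∣

{-# OPTIONS --safe #-}
module Submission where

-- Write d(X) = |X| − |N(X)|. For a stable set X and a maximum stable set S,
-- the set (S ∖ N[X]) ∪ X is stable, hence no larger than S, which gives
-- |X ∖ S| ≤ |N(X) ∩ S|; as N(X ∩ S) avoids S, this yields d(X ∩ S) ≥ d(X).
-- A maximum stable set has d ≥ α − (n − α) > 0, and repeatedly replacing X by
-- X ∩ S, for a maximum stable set S missing some vertex of X, ends in a stable
-- Y ⊆ core(G) with |Y| > |N(Y)|. Either N(Y) ≠ ∅, and then ξ(G) ≥ |Y| ≥ 2, or
-- Y consists of isolated vertices; the same exchange inequality, applied to the
-- set of isolated vertices, puts all of them in the core.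

open import Defs
open import Data.Bool using (Bool; true; false; not; _∧_; T)
open import Data.Bool.ListAction using (all; any)
open import Data.Bool.Properties using (T-≡; T-∧)
open import Data.Fin using (Fin; zero; suc)
open import Data.Fin.Subset using (Subset; ⊥; inside; outside; ∣_∣; _∈_; _∉_; _⊆_; _∩_; _∪_; ∁; Empty)
open import Data.Fin.Subset.Properties
  using (∣⊥∣≡0; ∉⊥; Empty-unique; nonempty?; _∈?_; p⊆q⇒∣p∣≤∣q∣; p⊂q⇒∣p∣<∣q∣; x∈p⇒∣p-x∣<∣p∣; ∣p∣≤n; ∣∁p∣≡n∸∣p∣;
         x∈p∩q⁺; x∈p∩q⁻; p∩q⊆p; ∣p∩q∣≤∣p∣; ∩-comm; x∈p∪q⁻; x∈∁p⇒x∉p; x∉p⇒x∈∁p)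
open import Data.List using (List; map; foldr)
open import Data.List.Membership.Propositional using (find; lose) renaming (_∈_ to _∈ᴸ_)
open import Data.List.Membership.Propositional.Properties using (∈-map⁺; ∈-map⁻; ∈-filter⁺; ∈-filter⁻; ∈-++⁺ˡ; ∈-++⁺ʳ)
open import Data.List.Properties using (foldr-preservesᵇ; foldr-preservesᵒ)
open import Data.List.Relation.Unary.All as All using (All)
open import Data.List.Relation.Unary.All.Properties using (all⁺; all⁻; ¬All⇒Any¬)
open import Data.List.Relation.Unary.Any as Any using (here; there)
open import Data.List.Relation.Unary.Any.Properties using (any⁺; any⁻)
open import Data.Nat using (ℕ; zero; suc; _+_; _*_; _∸_; _⊔_; _≤_; _<_; z≤n; s≤s)
open import Data.Nat.Induction using (<-wellFounded)
open import Data.Nat.Properties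
open import Algebra.Properties.CommutativeSemigroup +-commutativeSemigroup using (xy∙z≈xz∙y)
open import Data.Product using (_×_; _,_; proj₁; proj₂; ∃-syntax)
open import Data.Sum using (_⊎_; inj₁; inj₂; [_,_])
open import Data.Vec using ([]; _∷_; lookup; tabulate)
open import Data.Vec.Properties using ([]=⇒lookup; lookup⇒[]=; lookup∘tabulate)
open import Function using (_∘_)
open import Function.Bundles using (Equivalence)
open import Induction.WellFounded using (Acc; acc)
open import Relation.Binary.PropositionalEquality using (_≡_; _≢_; refl; cong; subst; trans; module ≡-Reasoning)
  renaming (sym to ≡-sym)
open import Relation.Nullary using (¬_; yes; no; contradiction)
open import Relation.Nullary.Decidable using (T?; decidable-stable)

private
  variable
    n : ℕ
    p q : Subset n
    x : Fin n

∣p∩q∣+∣p∩∁q∣≡∣p∣ : ∀ (p q : Subset n) → ∣ p ∩ q ∣ + ∣ p ∩ ∁ q ∣ ≡ ∣ p ∣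
∣p∩q∣+∣p∩∁q∣≡∣p∣ []            []            = refl
∣p∩q∣+∣p∩∁q∣≡∣p∣ (inside  ∷ p) (inside  ∷ q) = cong suc (∣p∩q∣+∣p∩∁q∣≡∣p∣ p q)
∣p∩q∣+∣p∩∁q∣≡∣p∣ (inside  ∷ p) (outside ∷ q) = trans (+-suc _ _) (cong suc (∣p∩q∣+∣p∩∁q∣≡∣p∣ p q))
∣p∩q∣+∣p∩∁q∣≡∣p∣ (outside ∷ p) (_       ∷ q) = ∣p∩q∣+∣p∩∁q∣≡∣p∣ p q

∣p∪q∣+∣p∩q∣≡∣p∣+∣q∣ : ∀ (p q : Subset n) → ∣ p ∪ q ∣ + ∣ p ∩ q ∣ ≡ ∣ p ∣ + ∣ q ∣
∣p∪q∣+∣p∩q∣≡∣p∣+∣q∣ []            []            = refl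
∣p∪q∣+∣p∩q∣≡∣p∣+∣q∣ (inside  ∷ p) (inside  ∷ q) =
  cong suc (trans (+-suc _ _) (trans (cong suc (∣p∪q∣+∣p∩q∣≡∣p∣+∣q∣ p q)) (≡-sym (+-suc _ _))))
∣p∪q∣+∣p∩q∣≡∣p∣+∣q∣ (inside  ∷ p) (outside ∷ q) = cong suc (∣p∪q∣+∣p∩q∣≡∣p∣+∣q∣ p q)
∣p∪q∣+∣p∩q∣≡∣p∣+∣q∣ (outside ∷ p) (inside  ∷ q) =
  trans (cong suc (∣p∪q∣+∣p∩q∣≡∣p∣+∣q∣ p q)) (≡-sym (+-suc _ _))
∣p∪q∣+∣p∩q∣≡∣p∣+∣q∣ (outside ∷ p) (outside ∷ q) = ∣p∪q∣+∣p∩q∣≡∣p∣+∣q∣ p q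

Empty⇒∣p∣≡0 : Empty p → ∣ p ∣ ≡ 0
Empty⇒∣p∣≡0 {n} empty = trans (cong ∣_∣ (Empty-unique empty)) (∣⊥∣≡0 n)

Empty[p∩q]⇒∣p∪q∣≡∣p∣+∣q∣ : Empty (p ∩ q) → ∣ p ∪ q ∣ ≡ ∣ p ∣ + ∣ q ∣
Empty[p∩q]⇒∣p∪q∣≡∣p∣+∣q∣ {p = p} {q} empty = begin
  ∣ p ∪ q ∣               ≡⟨ ≡-sym (+-identityʳ _) ⟩
  ∣ p ∪ q ∣ + 0           ≡⟨ cong (∣ p ∪ q ∣ +_) (≡-sym (Empty⇒∣p∣≡0 empty)) ⟩
  ∣ p ∪ q ∣ + ∣ p ∩ q ∣   ≡⟨ ∣p∪q∣+∣p∩q∣≡∣p∣+∣q∣ p q ⟩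
  ∣ p ∣ + ∣ q ∣           ∎
  where open ≡-Reasoning

x∈p⇒0<∣p∣ : x ∈ p → 0 < ∣ p ∣
x∈p⇒0<∣p∣ x∈p = ≤-<-trans z≤n (x∈p⇒∣p-x∣<∣p∣ x∈p)

x∈p∧x∉q⇒∣p∩q∣<∣p∣ : x ∈ p → x ∉ q → ∣ p ∩ q ∣ < ∣ p ∣
x∈p∧x∉q⇒∣p∩q∣<∣p∣ {p = p} {q = q} x∈p x∉q = p⊂q⇒∣p∣<∣q∣ (p∩q⊆p p q , _ , x∈p , x∉q ∘ proj₂ ∘ x∈p∩q⁻ p q)

⊆-or-witness : ∀ (p q : Subset n) → p ⊆ q ⊎ ∃[ x ] x ∈ p × x ∉ q
⊆-or-witness p q with nonempty? (p ∩ ∁ q)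
... | yes (x , x∈p∩∁q) = let x∈p , x∈∁q = x∈p∩q⁻ p (∁ q) x∈p∩∁q in inj₂ (x , x∈p , x∈∁p⇒x∉p x∈∁q)
... | no  p∩∁q-empty   = inj₁ λ {x} x∈p → decidable-stable (x ∈? q) λ x∉q →
                           p∩∁q-empty (x , x∈p∩q⁺ (x∈p , x∉p⇒x∈∁p x∉q))

T-lookup⇒∈ : T (lookup p x) → x ∈ p
T-lookup⇒∈ {p = p} {x} t = lookup⇒[]= x p (Equivalence.to T-≡ t)

∈⇒T-lookup : x ∈ p → T (lookup p x)
∈⇒T-lookup x∈p = Equivalence.from T-≡ ([]=⇒lookup x∈p)

∈-tabulate⁺ : ∀ {f : Fin n → Bool} → T (f x) → x ∈ tabulate f
∈-tabulate⁺ {x = x} {f} t = T-lookup⇒∈ (subst T (≡-sym (lookup∘tabulate f x)) t)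

∈-tabulate⁻ : ∀ {f : Fin n → Bool} → x ∈ tabulate f → T (f x)
∈-tabulate⁻ {x = x} {f} x∈ = subst T (lookup∘tabulate f x) (∈⇒T-lookup x∈)

T-not⁺ : ∀ {b} → ¬ T b → T (not b)
T-not⁺ {false} _  = _
T-not⁺ {true}  ¬t = ¬t _

T-not⁻ : ∀ {b} → T (not b) → ¬ T b
T-not⁻ {false} _ ()

∈-vertices : ∀ (v : Fin n) → v ∈ᴸ vertices n
∈-vertices zero    = here refl
∈-vertices (suc v) = there (∈-map⁺ suc (∈-vertices v))

∈-allSubsets : ∀ (S : Subset n) → S ∈ᴸ allSubsets n
∈-allSubsets []            = here refl
∈-allSubsets (inside  ∷ S) = ∈-++⁺ˡ (∈-map⁺ (inside ∷_) (∈-allSubsets S))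
∈-allSubsets (outside ∷ S) = ∈-++⁺ʳ _ (∈-map⁺ (outside ∷_) (∈-allSubsets S))

module _ (f : Fin n → Bool) where

  all-vertices⁺ : (∀ v → T (f v)) → T (all f (vertices n))
  all-vertices⁺ t = all⁻ f (All.universal t (vertices n))

  all-vertices⁻ : T (all f (vertices n)) → ∀ v → T (f v)
  all-vertices⁻ t v = All.lookup (all⁺ f (vertices n) t) (∈-vertices v)

  any-vertices⁺ : ∀ {v} → T (f v) → T (any f (vertices n))
  any-vertices⁺ t = any⁺ f (lose (∈-vertices _) t)

  any-vertices⁻ : T (any f (vertices n)) → ∃[ v ] T (f v)
  any-vertices⁻ t = Any.satisfied (any⁻ f (vertices n) t)

foldr-⊔-upperBound : ∀ {m e} (xs : List ℕ) → m ∈ᴸ xs → m ≤ foldr _⊔_ e xs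
foldr-⊔-upperBound {m} {e} xs m∈xs =
  foldr-preservesᵒ (λ a b → [ m≤n⇒m≤n⊔o b , m≤n⇒m≤o⊔n a ]) e xs (inj₂ (Any.map ≤-reflexive m∈xs))

foldr-⊔-∈ : ∀ {e} (xs : List ℕ) → e ∈ᴸ xs → foldr _⊔_ e xs ∈ᴸ xs
foldr-⊔-∈ xs e∈xs = foldr-preservesᵇ {P = _∈ᴸ xs} ⊔-∈ e∈xs (All.tabulate (λ m∈xs → m∈xs))
  where
  ⊔-∈ : ∀ {a b} → a ∈ᴸ xs → b ∈ᴸ xs → a ⊔ b ∈ᴸ xs
  ⊔-∈ {a} {b} a∈xs b∈xs with ⊔-sel a b
  ... | inj₁ a⊔b≡a = subst (_∈ᴸ xs) (≡-sym a⊔b≡a) a∈xs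
  ... | inj₂ a⊔b≡b = subst (_∈ᴸ xs) (≡-sym a⊔b≡b) b∈xs

module _ (G : Graph n) where

  Adj : Fin n → Fin n → Set
  Adj u v = T (adj G u v)

  Adj-sym : ∀ {u v} → Adj u v → Adj v u
  Adj-sym {u} {v} = subst T (Graph.sym G u v)

  Stable : Subset n → Set
  Stable S = ∀ {u v} → u ∈ S → v ∈ S → ¬ Adj u v

  Maximum : Subset n → Set
  Maximum S = Stable S × ∣ S ∣ ≡ α G

  N : Subset n → Subset n
  N X = tabulate λ v → any (λ u → lookup X u ∧ adj G u v) (vertices n)

  -- X ≤ᵈ Y says d(X) ≤ d(Y) for d(X) = |X| − |N(X)|, stated without subtraction.
  _≤ᵈ_ : Subset n → Subset n → Set
  X ≤ᵈ Y = ∣ X ∣ + ∣ N Y ∣ ≤ ∣ Y ∣ + ∣ N X ∣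

  ∈-N⁺ : ∀ {X u v} → u ∈ X → Adj u v → v ∈ N X
  ∈-N⁺ {X} {u} {v} u∈X u~v =
    ∈-tabulate⁺ (any-vertices⁺ (λ w → lookup X w ∧ adj G w v) (Equivalence.from T-∧ (∈⇒T-lookup u∈X , u~v)))

  ∈-N⁻ : ∀ {X v} → v ∈ N X → ∃[ u ] u ∈ X × Adj u v
  ∈-N⁻ v∈NX with any-vertices⁻ _ (∈-tabulate⁻ v∈NX)
  ... | u , t = let u∈X , u~v = Equivalence.to T-∧ t in u , T-lookup⇒∈ u∈X , u~v

  Stable-⊆ : ∀ {X Y} → Y ⊆ X → Stable X → Stable Y
  Stable-⊆ Y⊆X X-stable u∈Y v∈Y = X-stable (Y⊆X u∈Y) (Y⊆X v∈Y)

  Stable⇒N⊆∁ : ∀ {S} → Stable S → N S ⊆ ∁ S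
  Stable⇒N⊆∁ S-stable v∈NS =
    let u , u∈S , u~v = ∈-N⁻ v∈NS in x∉p⇒x∈∁p λ v∈S → S-stable u∈S v∈S u~v

  Stable⇒isStable : ∀ {S} → Stable S → T (isStable G S)
  Stable⇒isStable {S} S-stable =
    all-vertices⁺ _ λ u →
    all-vertices⁺ (λ v → not (lookup S u ∧ lookup S v ∧ adj G u v)) λ v →
    T-not⁺ λ t →
      let su , t′  = Equivalence.to T-∧ t
          sv , u~v = Equivalence.to T-∧ t′
      in S-stable (T-lookup⇒∈ su) (T-lookup⇒∈ sv) u~v

  isStable⇒Stable : ∀ {S} → T (isStable G S) → Stable S
  isStable⇒Stable t {u} {v} u∈S v∈S u~v =
    T-not⁻ (all-vertices⁻ _ (all-vertices⁻ _ t u) v)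
      (Equivalence.from T-∧ (∈⇒T-lookup u∈S , Equivalence.from T-∧ (∈⇒T-lookup v∈S , u~v)))

  Stable⇒∈stableSets : ∀ {S} → Stable S → S ∈ᴸ stableSets G
  Stable⇒∈stableSets {S} S-stable =
    ∈-filter⁺ (λ S → T? (isStable G S)) (∈-allSubsets S) (Stable⇒isStable S-stable)

  ∈stableSets⇒Stable : ∀ {S} → S ∈ᴸ stableSets G → Stable S
  ∈stableSets⇒Stable S∈ =
    isStable⇒Stable (proj₂ (∈-filter⁻ (λ S → T? (isStable G S)) {xs = allSubsets n} S∈))

  Stable⇒∣S∣≤α : ∀ {S} → Stable S → ∣ S ∣ ≤ α G
  Stable⇒∣S∣≤α S-stable = foldr-⊔-upperBound _ (∈-map⁺ ∣_∣ (Stable⇒∈stableSets S-stable))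

  maximum-exists : ∃[ S ] Maximum S
  maximum-exists =
    let S , S∈stableSets , α≡∣S∣ = ∈-map⁻ ∣_∣ (foldr-⊔-∈ (map ∣_∣ (stableSets G)) 0∈sizes)
    in S , ∈stableSets⇒Stable S∈stableSets , ≡-sym α≡∣S∣
    where
    0∈sizes : 0 ∈ᴸ map ∣_∣ (stableSets G)
    0∈sizes = subst (_∈ᴸ map ∣_∣ (stableSets G)) (∣⊥∣≡0 n)
                (∈-map⁺ ∣_∣ (Stable⇒∈stableSets {⊥} λ u∈⊥ → contradiction u∈⊥ ∉⊥))

  ∈Ω⇒Maximum : ∀ {S} → S ∈ᴸ Ω G → Maximum S
  ∈Ω⇒Maximum {S} S∈Ω =
    let t = proj₂ (∈-filter⁻ (λ S → T? (isMaxStable G S)) {xs = allSubsets n} S∈Ω)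
        stable , size = Equivalence.to T-∧ t
    in isStable⇒Stable stable , ≡ᵇ⇒≡ ∣ S ∣ (α G) size

  ∈-core⁺ : ∀ {v} → (∀ {S} → Maximum S → v ∈ S) → v ∈ core G
  ∈-core⁺ v∈max = ∈-tabulate⁺ (all⁻ _ (All.tabulate λ S∈Ω → ∈⇒T-lookup (v∈max (∈Ω⇒Maximum S∈Ω))))

  ∉-core⁻ : ∀ {v} → v ∉ core G → ∃[ S ] Maximum S × v ∉ S
  ∉-core⁻ {v} v∉core =
    let S , S∈Ω , ¬t = find (¬All⇒Any¬ (λ S → T? (lookup S v)) (Ω G) λ all-in →
                         v∉core (∈-tabulate⁺ (all⁻ (λ S → lookup S v) all-in)))
    in S , ∈Ω⇒Maximum S∈Ω , ¬t ∘ ∈⇒T-lookup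

  ∈-isolated⁺ : ∀ {v} → (∀ w → ¬ Adj v w) → v ∈ isolated G
  ∈-isolated⁺ no-neighbour =
    ∈-tabulate⁺ (T-not⁺ λ t → let w , v~w = any-vertices⁻ _ t in no-neighbour w v~w)

  ∈-isolated⁻ : ∀ {v w} → v ∈ isolated G → ¬ Adj v w
  ∈-isolated⁻ v∈I v~w = T-not⁻ (∈-tabulate⁻ v∈I) (any-vertices⁺ (adj G _) v~w)

  exchange : ∀ {X S} → Stable X → Maximum S → ∣ X ∩ ∁ S ∣ ≤ ∣ N X ∩ S ∣
  exchange {X} {S} X-stable (S-stable , ∣S∣≡α) = begin
    ∣ X ∩ ∁ S ∣          ≤⟨ +-cancelʳ-≤ ∣ R ∣ _ _ (+-cancelˡ-≤ ∣ S ∩ X ∣ _ _ counting) ⟩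
    ∣ (S ∩ ∁ X) ∩ N X ∣  ≤⟨ p⊆q⇒∣p∣≤∣q∣ S∖X∩NX⊆NX∩S ⟩
    ∣ N X ∩ S ∣          ∎
    where
    open ≤-Reasoning
    R : Subset _
    R = (S ∩ ∁ X) ∩ ∁ (N X)

    ∈R⁻ : ∀ {v} → v ∈ R → v ∈ S × v ∉ X × v ∉ N X
    ∈R⁻ v∈R = let v∈S∖X , v∈∁NX = x∈p∩q⁻ (S ∩ ∁ X) (∁ (N X)) v∈R
                  v∈S , v∈∁X = x∈p∩q⁻ S (∁ X) v∈S∖X
              in v∈S , x∈∁p⇒x∉p v∈∁X , x∈∁p⇒x∉p v∈∁NX

    X∪R-stable : Stable (X ∪ R)
    X∪R-stable u∈ v∈ with x∈p∪q⁻ X R u∈ | x∈p∪q⁻ X R v∈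
    ... | inj₁ u∈X | inj₁ v∈X = X-stable u∈X v∈X
    ... | inj₂ u∈R | inj₂ v∈R = S-stable (proj₁ (∈R⁻ u∈R)) (proj₁ (∈R⁻ v∈R))
    ... | inj₁ u∈X | inj₂ v∈R = λ u~v → proj₂ (proj₂ (∈R⁻ v∈R)) (∈-N⁺ u∈X u~v)
    ... | inj₂ u∈R | inj₁ v∈X = λ u~v → proj₂ (proj₂ (∈R⁻ u∈R)) (∈-N⁺ v∈X (Adj-sym u~v))

    X∩R-empty : Empty (X ∩ R)
    X∩R-empty (v , v∈X∩R) = let v∈X , v∈R = x∈p∩q⁻ X R v∈X∩R in proj₁ (proj₂ (∈R⁻ v∈R)) v∈X

    S∖X∩NX⊆NX∩S : (S ∩ ∁ X) ∩ N X ⊆ N X ∩ S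
    S∖X∩NX⊆NX∩S v∈ = let v∈S∖X , v∈NX = x∈p∩q⁻ (S ∩ ∁ X) (N X) v∈ in x∈p∩q⁺ (v∈NX , p∩q⊆p S (∁ X) v∈S∖X)

    counting : ∣ S ∩ X ∣ + (∣ X ∩ ∁ S ∣ + ∣ R ∣) ≤ ∣ S ∩ X ∣ + (∣ (S ∩ ∁ X) ∩ N X ∣ + ∣ R ∣)
    counting = begin
      ∣ S ∩ X ∣ + (∣ X ∩ ∁ S ∣ + ∣ R ∣)        ≡⟨ ≡-sym (+-assoc ∣ S ∩ X ∣ _ _) ⟩
      ∣ S ∩ X ∣ + ∣ X ∩ ∁ S ∣ + ∣ R ∣          ≡⟨ cong (λ k → ∣ k ∣ + ∣ X ∩ ∁ S ∣ + ∣ R ∣) (∩-comm S X) ⟩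
      ∣ X ∩ S ∣ + ∣ X ∩ ∁ S ∣ + ∣ R ∣          ≡⟨ cong (_+ ∣ R ∣) (∣p∩q∣+∣p∩∁q∣≡∣p∣ X S) ⟩
      ∣ X ∣ + ∣ R ∣                            ≡⟨ ≡-sym (Empty[p∩q]⇒∣p∪q∣≡∣p∣+∣q∣ X∩R-empty) ⟩
      ∣ X ∪ R ∣                                ≤⟨ Stable⇒∣S∣≤α X∪R-stable ⟩
      α G                                      ≡⟨ ≡-sym ∣S∣≡α ⟩
      ∣ S ∣                                    ≡⟨ ≡-sym (∣p∩q∣+∣p∩∁q∣≡∣p∣ S X) ⟩
      ∣ S ∩ X ∣ + ∣ S ∩ ∁ X ∣                  ≡⟨ cong (∣ S ∩ X ∣ +_) (≡-sym (∣p∩q∣+∣p∩∁q∣≡∣p∣ (S ∩ ∁ X) (N X))) ⟩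
      ∣ S ∩ X ∣ + (∣ (S ∩ ∁ X) ∩ N X ∣ + ∣ R ∣) ∎

  ≤ᵈ-refl : ∀ {X} → X ≤ᵈ X
  ≤ᵈ-refl = ≤-refl

  ≤ᵈ-trans : ∀ {X Y Z} → X ≤ᵈ Y → Y ≤ᵈ Z → X ≤ᵈ Z
  ≤ᵈ-trans {X} {Y} {Z} X≤Y Y≤Z = +-cancelʳ-≤ ∣ N Y ∣ _ _ (begin
    ∣ X ∣ + ∣ N Z ∣ + ∣ N Y ∣   ≡⟨ xy∙z≈xz∙y ∣ X ∣ _ _ ⟩
    ∣ X ∣ + ∣ N Y ∣ + ∣ N Z ∣   ≤⟨ +-monoˡ-≤ ∣ N Z ∣ X≤Y ⟩
    ∣ Y ∣ + ∣ N X ∣ + ∣ N Z ∣   ≡⟨ xy∙z≈xz∙y ∣ Y ∣ _ _ ⟩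
    ∣ Y ∣ + ∣ N Z ∣ + ∣ N X ∣   ≤⟨ +-monoˡ-≤ ∣ N X ∣ Y≤Z ⟩
    ∣ Z ∣ + ∣ N Y ∣ + ∣ N X ∣   ≡⟨ xy∙z≈xz∙y ∣ Z ∣ _ _ ⟩
    ∣ Z ∣ + ∣ N X ∣ + ∣ N Y ∣   ∎)
    where open ≤-Reasoning

  ≤ᵈ-surplus : ∀ {X Y} → X ≤ᵈ Y → ∣ N X ∣ < ∣ X ∣ → ∣ N Y ∣ < ∣ Y ∣
  ≤ᵈ-surplus {X} {Y} X≤Y NX<X = +-cancelˡ-< ∣ X ∣ _ _ (begin-strict
    ∣ X ∣ + ∣ N Y ∣   ≤⟨ X≤Y ⟩
    ∣ Y ∣ + ∣ N X ∣   <⟨ +-monoʳ-< ∣ Y ∣ NX<X ⟩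
    ∣ Y ∣ + ∣ X ∣     ≡⟨ +-comm ∣ Y ∣ ∣ X ∣ ⟩
    ∣ X ∣ + ∣ Y ∣     ∎)
    where open ≤-Reasoning

  ≤ᵈ-∩-maximum : ∀ {X S} → Stable X → Maximum S → X ≤ᵈ (X ∩ S)
  ≤ᵈ-∩-maximum {X} {S} X-stable S-max = begin
    ∣ X ∣ + ∣ N (X ∩ S) ∣                         ≡⟨ cong (_+ ∣ N (X ∩ S) ∣) (≡-sym (∣p∩q∣+∣p∩∁q∣≡∣p∣ X S)) ⟩
    ∣ X ∩ S ∣ + ∣ X ∩ ∁ S ∣ + ∣ N (X ∩ S) ∣       ≤⟨ +-mono-≤ (+-monoʳ-≤ ∣ X ∩ S ∣ (exchange X-stable S-max))
                                                               (p⊆q⇒∣p∣≤∣q∣ N[X∩S]⊆NX∖S) ⟩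
    ∣ X ∩ S ∣ + ∣ N X ∩ S ∣ + ∣ N X ∩ ∁ S ∣       ≡⟨ +-assoc ∣ X ∩ S ∣ _ _ ⟩
    ∣ X ∩ S ∣ + (∣ N X ∩ S ∣ + ∣ N X ∩ ∁ S ∣)     ≡⟨ cong (∣ X ∩ S ∣ +_) (∣p∩q∣+∣p∩∁q∣≡∣p∣ (N X) S) ⟩
    ∣ X ∩ S ∣ + ∣ N X ∣                           ∎
    where
    open ≤-Reasoning
    N[X∩S]⊆NX∖S : N (X ∩ S) ⊆ N X ∩ ∁ S
    N[X∩S]⊆NX∖S v∈ =
      let u , u∈X∩S , u~v = ∈-N⁻ v∈
          u∈X , u∈S = x∈p∩q⁻ X S u∈X∩S
      in x∈p∩q⁺ (∈-N⁺ u∈X u~v , x∉p⇒x∈∁p λ v∈S → proj₁ S-max u∈S v∈S u~v)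

  descend-to-core : ∀ {X} → Stable X → ∃[ Y ] Y ⊆ core G × X ≤ᵈ Y
  descend-to-core X-stable = descend-acc (<-wellFounded _) X-stable
    where
    descend-acc : ∀ {X} → Acc _<_ ∣ X ∣ → Stable X → ∃[ Y ] Y ⊆ core G × X ≤ᵈ Y
    descend-acc {X} (acc smaller) X-stable with ⊆-or-witness X (core G)
    ... | inj₁ X⊆core = X , X⊆core , ≤ᵈ-refl {X}
    ... | inj₂ (x , x∈X , x∉core) =
      let S , S-max , x∉S = ∉-core⁻ x∉core
          Y , Y⊆core , X∩S≤Y = descend-acc {X ∩ S} (smaller (x∈p∧x∉q⇒∣p∩q∣<∣p∣ x∈X x∉S))
                                            (Stable-⊆ (p∩q⊆p X S) X-stable)
      in Y , Y⊆core , ≤ᵈ-trans {X} {X ∩ S} {Y} (≤ᵈ-∩-maximum X-stable S-max) X∩S≤Y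

  maximum-surplus : n < 2 * α G → ∀ {S} → Maximum S → ∣ N S ∣ < ∣ S ∣
  maximum-surplus n<2α {S} (S-stable , ∣S∣≡α) = +-cancelˡ-< ∣ S ∣ _ _ (begin-strict
    ∣ S ∣ + ∣ N S ∣         ≤⟨ +-monoʳ-≤ ∣ S ∣ (p⊆q⇒∣p∣≤∣q∣ (Stable⇒N⊆∁ S-stable)) ⟩
    ∣ S ∣ + ∣ ∁ S ∣         ≡⟨ cong (∣ S ∣ +_) (∣∁p∣≡n∸∣p∣ S) ⟩
    ∣ S ∣ + (n ∸ ∣ S ∣)     ≡⟨ m+[n∸m]≡n (∣p∣≤n S) ⟩
    n                       <⟨ n<2α ⟩
    2 * α G                 ≡⟨ cong (λ a → a + (a + 0)) (≡-sym ∣S∣≡α) ⟩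
    ∣ S ∣ + (∣ S ∣ + 0)     ≡⟨ cong (∣ S ∣ +_) (+-identityʳ ∣ S ∣) ⟩
    ∣ S ∣ + ∣ S ∣           ∎)
    where open ≤-Reasoning

  isolated⊆core : isolated G ⊆ core G
  isolated⊆core v∈I = ∈-core⁺ λ {S} S-max → decidable-stable (_ ∈? S) λ v∉S →
    <⇒≱ (x∈p⇒0<∣p∣ (x∈p∩q⁺ (v∈I , x∉p⇒x∈∁p v∉S))) (begin
      ∣ isolated G ∩ ∁ S ∣        ≤⟨ exchange I-stable S-max ⟩
      ∣ N (isolated G) ∩ S ∣      ≤⟨ ∣p∩q∣≤∣p∣ (N (isolated G)) S ⟩
      ∣ N (isolated G) ∣          ≡⟨ Empty⇒∣p∣≡0 NI-empty ⟩
      0                           ∎)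
    where
    open ≤-Reasoning
    I-stable : Stable (isolated G)
    I-stable u∈I _ = ∈-isolated⁻ u∈I
    NI-empty : Empty (N (isolated G))
    NI-empty (w , w∈NI) = let u , u∈I , u~w = ∈-N⁻ w∈NI in ∈-isolated⁻ u∈I u~w

  positive-surplus⇒2≤ξ⊎1≤numIsolated : ∀ {Y} → Y ⊆ core G → ∣ N Y ∣ < ∣ Y ∣ → 2 ≤ ξ G ⊎ 1 ≤ numIsolated G
  positive-surplus⇒2≤ξ⊎1≤numIsolated {Y} Y⊆core NY<Y with nonempty? (N Y)
  ... | yes (w , w∈NY) = inj₁ (≤-trans (≤-trans (s≤s (x∈p⇒0<∣p∣ w∈NY)) NY<Y) (p⊆q⇒∣p∣≤∣q∣ Y⊆core))
  ... | no  NY-empty   = inj₂ (≤-trans (subst (_< ∣ Y ∣) (Empty⇒∣p∣≡0 NY-empty) NY<Y) (p⊆q⇒∣p∣≤∣q∣ Y⊆isolated))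
    where
    Y⊆isolated : Y ⊆ isolated G
    Y⊆isolated v∈Y = ∈-isolated⁺ λ w v~w → NY-empty (w , ∈-N⁺ v∈Y v~w)

  2≤ξ⊎1≤numIsolated : n < 2 * α G → 2 ≤ ξ G ⊎ 1 ≤ numIsolated G
  2≤ξ⊎1≤numIsolated n<2α =
    let S , S-max = maximum-exists
        Y , Y⊆core , S≤Y = descend-to-core {S} (proj₁ S-max)
    in positive-surplus⇒2≤ξ⊎1≤numIsolated {Y} Y⊆core (≤ᵈ-surplus {S} {Y} S≤Y (maximum-surplus n<2α S-max))

theorem4 : (n : ℕ) → (G : Graph n) → n < 2 * α G →
    (numIsolated G ≢ 1 → 2 ≤ ξ G) × (ξ G ≡ 1 → numIsolated G ≡ 1) × (ξ G ≢ 0)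
theorem4 n G n<2α = conclude (p⊆q⇒∣p∣≤∣q∣ (isolated⊆core G)) (2≤ξ⊎1≤numIsolated G n<2α)
  where
  conclude : ∀ {i x} → i ≤ x → 2 ≤ x ⊎ 1 ≤ i → (i ≢ 1 → 2 ≤ x) × (x ≡ 1 → i ≡ 1) × x ≢ 0
  conclude _   (inj₁ 2≤x) =
    (λ _ → 2≤x) ,
    (λ { refl → contradiction 2≤x λ { (s≤s ()) } }) ,
    (λ { refl → contradiction 2≤x λ () })
  conclude i≤x (inj₂ 1≤i) =
    (λ i≢1 → ≤-trans (≤∧≢⇒< 1≤i (i≢1 ∘ ≡-sym)) i≤x) ,
    (λ { refl → ≤-antisym i≤x 1≤i }) ,
    (λ { refl → contradiction (≤-trans 1≤i i≤x) λ () })
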